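{- Let $G$ be any hamiltonian graph of size $n\geq 3$. For any algorithm $A$ of the class $\mathcal{DFS}$ and any starting node $v$, the overhead of $A$ on $G$ starting at $v$ satisfies $\mathcal{O}_A\leq\frac{2n-4}{n-1}$.
   Context: Exploration model: a graph $G=(V,E)$ is simple, connected, undirected, with distinct node labels and ports $1,\dots,d$ at each node of degree $d$. A mobile agent starts at node $v$ with a complete labeled map of $G$. A fault configuration is any set $F\subseteq E$ of faulty edges, unknown to the agent; faulty edges cannot be traversed, and on first visiting a node the agent learns which incident ports are faulty (others are free). $C$ is the connected component of $v$ in $(V,E\setminus F)$; exploration is finished when the last node of $C$ is visited (no return needed). The cost $\mathcal{C}(A,F)$ is the number of edge traversals; $opt(F)$ is the minimum number of traversals needed to visit all nodes of $C$ from $v$ by an agent knowing $F$; the overhead is $\mathcal{O}_A=\max_{F\subseteq E}\mathcal{C}(A,F)/opt(F)$ (ratio $1$ when $C=\{v\}$). A graph is hamiltonian if it has a simple cycle containing all nodes. Class $\mathcal{DFS}$: for each node $w$ fix a permutation $\sigma_w$ of the ports at $w$, and let $\alpha=(\sigma_w)_{w\in V}$. Algorithm $DFS(\alpha)$ calls Explore($v$), where Explore($w$) is: mark $w$; for each free port at $w$, in the order given by $\sigma_w$, leading to a neighbor $u$: if $u$ is unmarked, traverse the edge to $u$, call Explore($u$), and afterwards, if there are still unvisited nodes of $C$, traverse the edge back to $w$. $\mathcal{DFS}$ is the class of all algorithms $DFS(\alpha)$. -}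

module Defs where

open import Data.Nat using (ℕ; zero; suc; _+_; _≤_)
open import Data.Fin using (Fin; _≟_)
open import Data.Fin.Permutation using (Permutation′; _⟨$⟩ʳ_)
open import Data.Bool using (Bool; true; false; if_then_else_)
open import Data.List using (List; []; _∷_; _++_; length; map; allFin)
open import Data.List.Membership.Propositional using (_∈_)
open import Data.List.Relation.Unary.Unique.Propositional using (Unique)
open import Data.Product using (Σ; ∃; ∃-syntax; _×_; _,_)
open import Relation.Binary.PropositionalEquality using (_≡_; _≢_)
open import Relation.Nullary using (yes; no)
open import Function.Definitions using (Injective)

-- Port-labelled graph on the nodes Fin n (node labels are the elements of
-- Fin n, hence distinct).  Node w has degree (deg w) and port p ∈ Fin (deg w)
-- (ports 1..d are represented by Fin d) leads to neighbour (nbr w p).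
-- The number of edge traversals is length ws.
data WalkFrom {n : ℕ} (R : Fin n → Fin n → Set) : Fin n → List (Fin n) → Set where
  stop : ∀ {u} → WalkFrom R u []
  step : ∀ {u w ws} → R u w → WalkFrom R w ws → WalkFrom R u (w ∷ ws)

record PortGraph (n : ℕ) : Set where
  field
    deg     : Fin n → ℕ
    nbr     : (w : Fin n) → Fin (deg w) → Fin n
    nbr-inj : ∀ w → Injective _≡_ _≡_ (nbr w)
    no-loop : ∀ w p → nbr w p ≢ w
    -- undirected: every edge is seen from both endpoints
    nbr-sym : ∀ w p → ∃[ q ] nbr (nbr w p) q ≡ w

  Adj : Fin n → Fin n → Set
  Adj u w = ∃[ p ] nbr u p ≡ w

open PortGraph public

Connected : ∀ {n} → PortGraph n → Set
Connected {n} G = ∀ (u w : Fin n) → ∃[ ws ] (WalkFrom (Adj G) u ws × w ∈ u ∷ ws)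

Hamiltonian : ∀ {n} → PortGraph n → Set
Hamiltonian {n} G =
  ∃[ x ] ∃[ xs ] (WalkFrom (Adj G) x (xs ++ x ∷ []) × Unique (x ∷ xs) × length (x ∷ xs) ≡ n)

-- A fault configuration F ⊆ E: the edge {u,w} is faulty iff F u w ≡ true
-- (values on non-edges are irrelevant).
record Faults (n : ℕ) : Set where
  field
    faulty     : Fin n → Fin n → Bool
    faulty-sym : ∀ u w → faulty u w ≡ faulty w u

open Faults public

Free : ∀ {n} → PortGraph n → Faults n → Fin n → Fin n → Set
Free G F u w = Adj G u w × faulty F u w ≡ false

InC : ∀ {n} → PortGraph n → Faults n → Fin n → Fin n → Set
InC G F v u = ∃[ ws ] (WalkFrom (Free G F) v ws × u ∈ v ∷ ws)

Covers : ∀ {n} → PortGraph n → Faults n → Fin n → List (Fin n) → Set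
Covers {n} G F v ws = WalkFrom (Free G F) v ws × (∀ (u : Fin n) → InC G F v u → u ∈ v ∷ ws)

IsOpt : ∀ {n} → PortGraph n → Faults n → Fin n → ℕ → Set
IsOpt G F v k =
  (∃[ ws ] (Covers G F v ws × length ws ≡ k)) × (∀ ws → Covers G F v ws → k ≤ length ws)

PortOrders : ∀ {n} → PortGraph n → Set
PortOrders {n} G = (w : Fin n) → Permutation′ (deg G w)

-- State of the DFS agent: marked nodes, total number of traversals made so
-- far, and the number of traversals made at the moment the most recent new
-- node was first reached.
record St (n : ℕ) : Set where
  constructor st
  field
    marked   : Fin n → Bool
    moves    : ℕ
    lastDisc : ℕ

open St public

module DFSRun {n : ℕ} (G : PortGraph n) (α : PortOrders G) (F : Faults n) where

  mark : Fin n → St n → St n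
  mark w (st m c l) = st (λ x → if (x ≟ w) then' true else' m x) c l
    where
      if_then'_else'_ : ∀ {A B : Set} → Relation.Nullary.Dec A → B → B → B
      if (yes _) then' a else' b = a
      if (no _) then' a else' b = b

  goNew : St n → St n
  goNew (st m c l) = st m (suc c) (suc c)

  goBack : St n → St n
  goBack (st m c l) = st m (suc c) l

  ports : (w : Fin n) → List (Fin (deg G w))
  ports w = map (α w ⟨$⟩ʳ_) (allFin (deg G w))

  -- Explore with fuel (the recursion depth is at most n, so fuel n suffices)
  explore : ℕ → Fin n → St n → St n
  loop    : ℕ → (w : Fin n) → List (Fin (deg G w)) → St n → St n

  explore zero    w s = s
  explore (suc k) w s = loop k w (ports w) (mark w s)

  loop k w []       s = s
  loop k w (p ∷ ps) s with faulty F w (nbr G w p) | marked s (nbr G w p)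
  ... | true  | _     = loop k w ps s
  ... | false | true  = loop k w ps s
  ... | false | false = loop k w ps (goBack (explore k (nbr G w p) (goNew s)))

  -- Cost C(DFS(α), F): the full DFS walk returns to v, but the exploration
  -- ends when the last node of C is visited, i.e. the "traverse back" steps
  -- after the last discovery are exactly those not performed.  Hence the cost
  -- is the number of traversals made up to the last discovery.
  cost : Fin n → ℕ
  cost v = lastDisc (explore n v (st (λ _ → false) 0 0))

dfsCost : ∀ {n} (G : PortGraph n) → PortOrders G → Faults n → Fin n → ℕ
dfsCost G α F v = DFSRun.cost G α F v

module Submission where

-- Suppose the run of DFS(α) from v marks 1 + d nodes.  All of them lie in the
-- component C of v, so a covering walk has length k ≥ d, and 1 + d ≤ n.  The
-- complete DFS walk, returns included, makes exactly 2d traversals (`Spent`),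
-- so the cost c (traversals up to the last discovery) satisfies one of
-- (`Shape`): c + 2 ≤ 2d;  c = 0;  or c + 1 = 2d and the last subtree of v is a
-- single pendant node u whose only free neighbour is v -- then a covering walk
-- returns to v after u (k ≥ d + 1) or is the single step v → u (d ≤ 1).
-- Each case gives c (n - 1) ≤ (2n - 4) k by elementary arithmetic.

open import Defs
open import Data.Nat using (ℕ; zero; suc; _+_; _*_; _∸_; _≤_; _<_; z≤n; s≤s)
open import Data.Nat.Properties hiding (_≟_)
open import Data.Fin using (Fin; _≟_) renaming (zero to fzero; suc to fsuc)
open import Data.Fin.Properties using () renaming (suc-injective to fsuc-injective)
open import Data.Fin.Permutation using (_⟨$⟩ʳ_; _⟨$⟩ˡ_; inverseʳ)
open import Data.Bool using (Bool; true; false)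
open import Data.List using (List; []; _∷_; length)
open import Data.List.Membership.Propositional using (_∈_)
open import Data.List.Membership.Propositional.Properties using (∈-map⁺; ∈-allFin)
open import Data.List.Relation.Unary.Any using (here; there; any?)
open import Data.Product using (∃-syntax; _×_; _,_; proj₁; proj₂)
open import Data.Sum using (_⊎_; inj₁; inj₂)
open import Data.Empty using (⊥-elim)
open import Function using (_∘_)
open import Relation.Nullary using (¬_; does; yes; no)
open import Relation.Binary.PropositionalEquality

-- Counting the true values of a Boolean predicate on Fin n

true≢false : true ≢ false
true≢false ()

indicator : Bool → ℕ
indicator true  = 1
indicator false = 0

count : ∀ {n} → (Fin n → Bool) → ℕ
count {zero}  f = 0
count {suc n} f = indicator (f fzero) + count (f ∘ fsuc)

_⊆ᵇ_ : ∀ {n} → (Fin n → Bool) → (Fin n → Bool) → Set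
f ⊆ᵇ g = ∀ x → f x ≡ true → g x ≡ true

indicator-mono : ∀ {a b} → (a ≡ true → b ≡ true) → indicator a ≤ indicator b
indicator-mono {false} _ = z≤n
indicator-mono {true}  h rewrite h refl = ≤-refl

indicator≤1 : ∀ b → indicator b ≤ 1
indicator≤1 true  = ≤-refl
indicator≤1 false = z≤n

count-ext : ∀ {n} {f g : Fin n → Bool} → (∀ x → f x ≡ g x) → count f ≡ count g
count-ext {zero}  _ = refl
count-ext {suc n} e = cong₂ _+_ (cong indicator (e fzero)) (count-ext (e ∘ fsuc))

count-false : ∀ n → count {n} (λ _ → false) ≡ 0
count-false zero    = refl
count-false (suc n) = count-false n

count-≤ : ∀ {n} (f : Fin n → Bool) → count f ≤ n
count-≤ {zero}  f = z≤n
count-≤ {suc n} f = +-mono-≤ (indicator≤1 (f fzero)) (count-≤ (f ∘ fsuc))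

count-mono : ∀ {n} {f g : Fin n → Bool} → f ⊆ᵇ g → count f ≤ count g
count-mono {zero}  _ = z≤n
count-mono {suc n} h = +-mono-≤ (indicator-mono (h fzero)) (count-mono (h ∘ fsuc))

count-insert : ∀ {n} {f g : Fin n → Bool} (w : Fin n) → f w ≡ false → g w ≡ true →
               (∀ x → x ≢ w → g x ≡ f x) → count g ≡ suc (count f)
count-insert {suc n} fzero fw gw agree
  rewrite fw | gw = cong suc (count-ext (λ x → agree (fsuc x) (λ ())))
count-insert {suc n} {f} {g} (fsuc w) fw gw agree =
  trans (cong₂ _+_ (cong indicator (agree fzero (λ ())))
                   (count-insert w fw gw (λ x x≢w → agree (fsuc x) (x≢w ∘ fsuc-injective))))
        (+-suc (indicator (f fzero)) _)

count-one-more : ∀ {n} {f g : Fin n → Bool} (a : Fin n) →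
                 (∀ x → f x ≡ true → g x ≡ true ⊎ x ≡ a) → count f ≤ suc (count g)
count-one-more {suc n} {f} {g} fzero h = begin
  indicator (f fzero) + count (f ∘ fsuc) ≤⟨ +-mono-≤ (indicator≤1 _) (count-mono tail) ⟩
  suc (count (g ∘ fsuc))                 ≤⟨ s≤s (m≤n+m _ (indicator (g fzero))) ⟩
  suc (count g)                          ∎
  where
  open ≤-Reasoning
  tail : (f ∘ fsuc) ⊆ᵇ (g ∘ fsuc)
  tail x fx with h (fsuc x) fx
  ... | inj₁ gx = gx
  ... | inj₂ ()
count-one-more {suc n} {f} {g} (fsuc a) h = begin
  indicator (f fzero) + count (f ∘ fsuc)       ≤⟨ +-mono-≤ (indicator-mono head) (count-one-more a tail) ⟩
  indicator (g fzero) + suc (count (g ∘ fsuc)) ≡⟨ +-suc _ _ ⟩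
  suc (count g)                                ∎
  where
  open ≤-Reasoning
  head : f fzero ≡ true → g fzero ≡ true
  head f0 with h fzero f0
  ... | inj₁ g0 = g0
  ... | inj₂ ()
  tail : ∀ x → f (fsuc x) ≡ true → g (fsuc x) ≡ true ⊎ x ≡ a
  tail x fx with h (fsuc x) fx
  ... | inj₁ gx = inj₁ gx
  ... | inj₂ refl = inj₂ refl

count-≤-length : ∀ {n} (L : List (Fin n)) {f : Fin n → Bool} →
                 (∀ x → f x ≡ true → x ∈ L) → count f ≤ length L
count-≤-length {n} [] {f} h = begin
  count f                   ≤⟨ count-mono {g = λ _ → false} (λ x fx → nothing-in-[] (h x fx)) ⟩
  count {n} (λ _ → false)   ≡⟨ count-false n ⟩
  0                         ∎
  where
  open ≤-Reasoning
  nothing-in-[] : ∀ {x} → x ∈ [] → false ≡ true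
  nothing-in-[] ()
count-≤-length {n} (a ∷ L) {f} h = ≤-trans (count-one-more a split) (s≤s (count-≤-length L membership))
  where
  onL : Fin n → Bool
  onL x = does (any? (x ≟_) L)
  split : ∀ x → f x ≡ true → onL x ≡ true ⊎ x ≡ a
  split x fx with h x fx | any? (x ≟_) L
  ... | here x≡a  | _      = inj₂ x≡a
  ... | there _   | yes _  = inj₁ refl
  ... | there x∈L | no x∉L = ⊥-elim (x∉L x∈L)
  membership : ∀ x → onL x ≡ true → x ∈ L
  membership x _ with any? (x ≟_) L
  membership x _  | yes x∈L = x∈L
  membership x () | no _

-- Walks (relative to any step relation R).

walk-extend : ∀ {n} {R : Fin n → Fin n → Set} {a ws y z} →
              WalkFrom R a ws → y ∈ a ∷ ws → R y z → ∃[ ws′ ] (WalkFrom R a ws′ × z ∈ a ∷ ws′)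
walk-extend {z = z} _ (here refl) r = z ∷ [] , step r stop , there (here refl)
walk-extend (step r walk) (there y∈ws) r′ with walk-extend walk y∈ws r′
... | ws′ , walk′ , z∈ws′ = _ , step r walk′ , there z∈ws′

entered-from : ∀ {n} {R : Fin n → Fin n → Set} {v u a ws} → (∀ y → R y u → y ≡ v) →
               WalkFrom R a ws → u ∈ ws → v ∈ a ∷ ws
entered-from only (step r _)    (here refl)  = here (sym (only _ r))
entered-from only (step _ walk) (there u∈ws) = there (entered-from only walk u∈ws)

through-pendant : ∀ {n} {R : Fin n → Fin n → Set} {v u ws} →
                  (∀ y → R y u → y ≡ v) → (∀ y → R u y → y ≡ v) →
                  WalkFrom R v ws → u ∈ ws → v ∈ ws ⊎ ws ≡ u ∷ []
through-pendant into _    (step _ walk)          (there u∈ws) = inj₁ (entered-from into walk u∈ws)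
through-pendant _    _    (step _ stop)          (here refl)  = inj₂ refl
through-pendant _    from (step _ (step r _))    (here refl)  = inj₁ (there (here (sym (from _ r))))

-- Arithmetic of the final bound.  With n = 2 + s nodes (s ≥ 1) we have
-- n - 1 = 1 + s and 2n - 4 = 2s; d ≤ 1 + s is the number of discovered nodes.

double-minus-four : ∀ s → 2 * (2 + s) ∸ 4 ≡ 2 * s
double-minus-four s = trans (cong (_∸ 4) (*-distribˡ-+ 2 2 s)) (m+n∸m≡n 4 (2 * s))

exchange-≤ : ∀ {j s} → j ≤ s → j * (1 + s) ≤ s * (1 + j)
exchange-≤ {j} {s} j≤s = begin
  j * (1 + s) ≡⟨ *-suc j s ⟩
  j + j * s   ≤⟨ +-monoˡ-≤ (j * s) j≤s ⟩
  s + j * s   ≡⟨ cong (s +_) (*-comm j s) ⟩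
  s + s * j   ≡⟨ sym (*-suc s j) ⟩
  s * (1 + j) ∎
  where open ≤-Reasoning

1+s≤2s : ∀ {s} → 1 ≤ s → 1 + s ≤ 2 * s
1+s≤2s {s} 1≤s = subst (1 + s ≤_) (cong (s +_) (sym (+-identityʳ s))) (+-monoˡ-≤ s 1≤s)

bound-when-returned : ∀ {s c d k} → 2 + c ≤ 2 * d → d ≤ 1 + s → d ≤ k → c * (1 + s) ≤ 2 * s * k
bound-when-returned {d = zero} ()
bound-when-returned {s} {c} {suc j} {k} c+2≤2d d≤1+s d≤k = begin
  c * (1 + s)         ≤⟨ *-monoˡ-≤ (1 + s) c≤2j ⟩
  2 * j * (1 + s)     ≡⟨ *-assoc 2 j (1 + s) ⟩
  2 * (j * (1 + s))   ≤⟨ *-monoʳ-≤ 2 (exchange-≤ (≤-pred d≤1+s)) ⟩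
  2 * (s * (1 + j))   ≡⟨ sym (*-assoc 2 s (1 + j)) ⟩
  2 * s * (1 + j)     ≤⟨ *-monoʳ-≤ (2 * s) d≤k ⟩
  2 * s * k           ∎
  where
  open ≤-Reasoning
  c≤2j : c ≤ 2 * j
  c≤2j = +-cancelˡ-≤ 2 c (2 * j) (subst (2 + c ≤_) (*-suc 2 j) c+2≤2d)

bound-when-pendant : ∀ {s c d k} → 1 ≤ s → suc c ≡ 2 * d → d ≤ 1 + s → d ≤ k →
                     (suc d ≤ k ⊎ d ≤ 1) → c * (1 + s) ≤ 2 * s * k
bound-when-pendant {d = zero} _ () _ _ _
bound-when-pendant {s} {c} {suc j} {k} 1≤s c+1≡2d d≤1+s d≤k long-or-short
  with suc-injective (trans c+1≡2d (*-suc 2 j))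
... | refl with long-or-short
...   | inj₂ (s≤s z≤n) = begin
  1 * (1 + s)   ≡⟨ *-identityˡ (1 + s) ⟩
  1 + s         ≤⟨ 1+s≤2s 1≤s ⟩
  2 * s         ≡⟨ sym (*-identityʳ (2 * s)) ⟩
  2 * s * 1     ≤⟨ *-monoʳ-≤ (2 * s) d≤k ⟩
  2 * s * k     ∎
  where open ≤-Reasoning
...   | inj₁ d+1≤k = begin
  (1 + 2 * j) * (1 + s)           ≡⟨ cong ((1 + s) +_) (*-assoc 2 j (1 + s)) ⟩
  (1 + s) + 2 * (j * (1 + s))     ≤⟨ +-mono-≤ (1+s≤2s 1≤s) (*-monoʳ-≤ 2 (exchange-≤ (≤-pred d≤1+s))) ⟩
  2 * s + 2 * (s * (1 + j))       ≡⟨ cong (2 * s +_) (sym (*-assoc 2 s (1 + j))) ⟩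
  2 * s + 2 * s * (1 + j)         ≡⟨ sym (*-suc (2 * s) (1 + j)) ⟩
  2 * s * (2 + j)                 ≤⟨ *-monoʳ-≤ (2 * s) d+1≤k ⟩
  2 * s * k                       ∎
  where open ≤-Reasoning

-- Invariants of the depth-first run of DFS(α) from v under faults F

module DFSInvariants {n : ℕ} (G : PortGraph n) (α : PortOrders G) (F : Faults n) (v : Fin n) where
  open DFSRun G α F

  FreeEdge : Fin n → Fin n → Set
  FreeEdge = Free G F

  free-sym : ∀ {y z} → FreeEdge y z → FreeEdge z y
  free-sym {y} ((p , refl) , free) with nbr-sym G y p
  ... | q , back = (q , back) , trans (faulty-sym F _ y) free

  free-irrefl : ∀ {u} → ¬ FreeEdge u u
  free-irrefl ((p , self) , _) = no-loop G _ p self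

  inC-step : ∀ {y z} → InC G F v y → FreeEdge y z → InC G F v z
  inC-step (ws , walk , y∈) e = walk-extend walk y∈ e

  ports-complete : ∀ w p → p ∈ ports w
  ports-complete w p =
    subst (_∈ ports w) (inverseʳ (α w)) (∈-map⁺ (α w ⟨$⟩ʳ_) (∈-allFin (α w ⟨$⟩ˡ p)))

  Marked : St n → Fin n → Set
  Marked s x = marked s x ≡ true

  C : St n → ℕ
  C s = count (marked s)

  mark-here : ∀ s w → Marked (mark w s) w
  mark-here s w with w ≟ w
  ... | yes _   = refl
  ... | no w≢w  = ⊥-elim (w≢w refl)

  mark-elsewhere : ∀ s w x → x ≢ w → marked (mark w s) x ≡ marked s x
  mark-elsewhere s w x x≢w with x ≟ w
  ... | yes x≡w = ⊥-elim (x≢w x≡w)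
  ... | no _    = refl

  mark-keeps : ∀ s w x → Marked s x → Marked (mark w s) x
  mark-keeps s w x m with x ≟ w
  ... | yes _ = refl
  ... | no _  = m

  count-mark : ∀ s w → marked s w ≡ false → C (mark w s) ≡ suc (C s)
  count-mark s w unmarked = count-insert w unmarked (mark-here s w) (mark-elsewhere s w)

  _⊑_ : St n → St n → Set
  s ⊑ e = marked s ⊆ᵇ marked e

  NewlyClosed : St n → St n → Set
  NewlyClosed s e = ∀ y → Marked e y → marked s y ≡ false → ∀ z → FreeEdge y z → Marked e z

  WithinC : St n → Set
  WithinC s = ∀ y → Marked s y → InC G F v y

  Spent : St n → St n → ℕ → Set
  Spent s e d = C e ≡ C s + d × moves e ≡ moves s + 2 * d

  Moved : St n → Set
  Moved e = lastDisc e < moves e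

  Unchanged : St n → St n → Set
  Unchanged s e = lastDisc e ≡ lastDisc s × moves e ≡ moves s × (∀ x → marked e x ≡ marked s x)

  spent-trans : ∀ {s e r d₁ d₂} → Spent s e d₁ → Spent e r d₂ → Spent s r (d₁ + d₂)
  spent-trans {s} {d₁ = d₁} {d₂} (Ce , me) (Cr , mr) =
      trans Cr (trans (cong (_+ d₂) Ce) (+-assoc (C s) d₁ d₂))
    , trans mr (trans (cong (_+ 2 * d₂) me)
               (trans (+-assoc (moves s) (2 * d₁) (2 * d₂)) (cong (moves s +_) (sym (*-distribˡ-+ 2 d₁ d₂)))))

  -- Going to a new node u, exploring it and coming back costs 2 traversals
  -- for u and 2 for each node discovered below u.
  spent-child : ∀ {s e u d} → marked s u ≡ false → Spent (mark u (goNew s)) e d →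
                Spent s (goBack e) (suc d)
  spent-child {s} {e} {u} {d} unmarked (Ce , me) =
      trans Ce (trans (cong (_+ d) (count-mark (goNew s) u unmarked)) (sym (+-suc (C s) d)))
    , (begin
        suc (moves e)                ≡⟨ cong suc me ⟩
        suc (suc (moves s) + 2 * d)  ≡⟨ cong suc (sym (+-suc (moves s) (2 * d))) ⟩
        suc (moves s + suc (2 * d))  ≡⟨ sym (+-suc (moves s) (suc (2 * d))) ⟩
        moves s + (2 + 2 * d)        ≡⟨ cong (moves s +_) (sym (*-suc 2 d)) ⟩
        moves s + 2 * suc d          ∎)
    where open ≡-Reasoning

  record ExploreSpec (w : Fin n) (s e : St n) : Set where
    field
      visits   : Marked e w
      grows    : s ⊑ e
      closed   : NewlyClosed s e
      within   : WithinC e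
      spent    : ∃[ d ] Spent (mark w s) e d
      progress : Moved e ⊎ Unchanged (mark w s) e

  record LoopSpec (w : Fin n) (ps : List (Fin (deg G w))) (s r : St n) : Set where
    field
      grows      : s ⊑ r
      closed     : NewlyClosed s r
      within     : WithinC r
      spent      : ∃[ d ] Spent s r d
      progress   : Moved r ⊎ Unchanged s r
      ports-done : ∀ p → p ∈ ps → faulty F w (nbr G w p) ≡ false → Marked r (nbr G w p)

  settled : ∀ {u s e} → Moved e ⊎ Unchanged (mark u (goNew s)) e → lastDisc e ≤ moves e
  settled (inj₁ moved)            = <⇒≤ moved
  settled (inj₂ (same , now , _)) = ≤-reflexive (trans same (sym now))

  skip-port : ∀ {w p ps s r} → LoopSpec w ps s r →
              (faulty F w (nbr G w p) ≡ false → Marked r (nbr G w p)) → LoopSpec w (p ∷ ps) s r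
  skip-port R done = record
    { grows = grows ; closed = closed ; within = within ; spent = spent ; progress = progress
    ; ports-done = λ { q (here refl) free → done free ; q (there q∈ps) free → ports-done q q∈ps free } }
    where open LoopSpec R

  discover-port : ∀ {w p ps s e r} → let u = nbr G w p in
                  marked s u ≡ false → ExploreSpec u (goNew s) e → LoopSpec w ps (goBack e) r →
                  LoopSpec w (p ∷ ps) s r
  discover-port {w} {p} {s = s} {e} {r} unmarked E R = record
    { grows      = λ x → R.grows x ∘ E.grows x
    ; closed     = closed
    ; within     = R.within
    ; spent      = spent
    ; progress   = inj₁ moved
    ; ports-done = λ { q (here refl) _ → R.grows _ E.visits ; q (there q∈ps) free → R.ports-done q q∈ps free }
    }
    where
    module E = ExploreSpec E
    module R = LoopSpec R
    closed : NewlyClosed s r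
    closed y marked-r unmarked-s z edge with marked e y in eq
    ... | true  = R.grows z (E.closed y eq unmarked-s z edge)
    ... | false = R.closed y marked-r eq z edge
    spent : ∃[ d ] Spent s r d
    spent with E.spent | R.spent
    ... | d₁ , Se | d₂ , Sr =
      suc d₁ + d₂ , spent-trans {s} {goBack e} {r} (spent-child {s} {e} {nbr G w p} unmarked Se) Sr
    moved : Moved r
    moved with R.progress
    ... | inj₁ moved-r          = moved-r
    ... | inj₂ (same , now , _) = subst₂ _<_ (sym same) (sym now) (s≤s (settled {nbr G w p} {s} E.progress))

  -- Each call marks a new node, so the invariant n ≤ k + C s ensures that the
  -- fuel k never runs out; every call then meets its specification.
  explore-spec : ∀ k w s → marked s w ≡ false → n ≤ k + C s → WithinC s → InC G F v w →
                 ExploreSpec w s (explore k w s)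
  loop-spec    : ∀ k w ps s → Marked s w → n ≤ k + C s → WithinC s → LoopSpec w ps s (loop k w ps s)

  explore-spec zero w s unmarked fuel _ _ =
    ⊥-elim (<⇒≱ (subst (_≤ n) (count-mark s w unmarked) (count-≤ _)) fuel)
  explore-spec (suc k) w s unmarked fuel within w∈C = record
    { visits   = R.grows w (mark-here s w)
    ; grows    = λ x → R.grows x ∘ mark-keeps s w x
    ; closed   = closed
    ; within   = R.within
    ; spent    = R.spent
    ; progress = R.progress
    }
    where
    s′ : St n
    s′ = mark w s
    within′ : WithinC s′
    within′ y m with y ≟ w
    ... | yes refl = w∈C
    ... | no _     = within y m
    fuel′ : n ≤ k + C s′
    fuel′ = subst (n ≤_) (trans (sym (+-suc k (C s))) (cong (k +_) (sym (count-mark s w unmarked)))) fuel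
    R : LoopSpec w (ports w) s′ (loop k w (ports w) s′)
    R = loop-spec k w (ports w) s′ (mark-here s w) fuel′ within′
    module R = LoopSpec R
    closed : NewlyClosed s (loop k w (ports w) s′)
    closed y m unmarked-s z edge with y ≟ w
    closed y m unmarked-s z ((q , refl) , free) | yes refl = R.ports-done q (ports-complete w q) free
    ... | no y≢w = R.closed y m (trans (mark-elsewhere s w y y≢w) unmarked-s) z edge

  loop-spec k w [] s _ _ within = record
    { grows      = λ _ m → m
    ; closed     = λ y m unmarked → ⊥-elim (true≢false (trans (sym m) unmarked))
    ; within     = within
    ; spent      = 0 , sym (+-identityʳ (C s)) , sym (+-identityʳ (moves s))
    ; progress   = inj₂ (refl , refl , λ _ → refl)
    ; ports-done = λ _ ()
    }
  loop-spec k w (p ∷ ps) s w-marked fuel within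
    with faulty F w (nbr G w p) in faulty-p | marked s (nbr G w p) in seen
  ... | true  | _    = skip-port (loop-spec k w ps s w-marked fuel within)
                                 (λ free → ⊥-elim (true≢false (trans (sym faulty-p) free)))
  ... | false | true = skip-port R (λ _ → LoopSpec.grows R _ seen)
    where
    R : LoopSpec w ps s (loop k w ps s)
    R = loop-spec k w ps s w-marked fuel within
  ... | false | false = discover-port seen E R
    where
    u : Fin n
    u = nbr G w p
    e : St n
    e = explore k u (goNew s)
    E : ExploreSpec u (goNew s) e
    E = explore-spec k u (goNew s) seen fuel within (inC-step (within w w-marked) ((p , refl) , faulty-p))
    R : LoopSpec w ps (goBack e) (loop k w ps (goBack e))
    R = loop-spec k w ps (goBack e) (ExploreSpec.grows E w w-marked)
                  (≤-trans fuel (+-monoʳ-≤ k (count-mono (ExploreSpec.grows E)))) (ExploreSpec.within E)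

  Pendant : Fin n → Set
  Pendant u = u ≢ v × FreeEdge v u × (∀ y → FreeEdge u y → y ≡ v)

  data Shape (s : St n) : Set where
    returned     : 2 + lastDisc s ≤ moves s → Shape s
    nothing-new  : lastDisc s ≡ 0 → Shape s
    pendant-last : ∀ {u} → suc (lastDisc s) ≡ moves s → Pendant u → Shape s

  ClosedAwayFromV : St n → Set
  ClosedAwayFromV s = ∀ y → Marked s y → y ≢ v → ∀ z → FreeEdge y z → Marked s z

  pendant-child : ∀ {s e u} → Marked s v → ClosedAwayFromV s → marked s u ≡ false → FreeEdge v u →
                  ExploreSpec u (goNew s) e → (∀ x → marked e x ≡ marked (mark u (goNew s)) x) → Pendant u
  pendant-child {s} {e} {u} v-marked closedᵥ unmarked edge E unchanged =
    u≢v , edge , only-v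
    where
    u≢v : u ≢ v
    u≢v refl = true≢false (trans (sym v-marked) unmarked)
    only-v : ∀ y → FreeEdge u y → y ≡ v
    only-v y u-y with y ≟ u | y ≟ v
    ... | yes refl | _      = ⊥-elim (free-irrefl u-y)
    ... | no _     | yes y≡v = y≡v
    ... | no y≢u   | no y≢v  = ⊥-elim (true≢false (trans (sym u-seen) unmarked))
      where
      y-seen : Marked s y
      y-seen = trans (sym (trans (unchanged y) (mark-elsewhere (goNew s) u y y≢u)))
                     (ExploreSpec.closed E u (ExploreSpec.visits E) unmarked y u-y)
      u-seen : Marked s u
      u-seen = closedᵥ y y-seen y≢v u (free-sym u-y)

  shape-loop : ∀ k ps s → Marked s v → n ≤ k + C s → WithinC s → ClosedAwayFromV s → Shape s →
               Shape (loop k v ps s)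
  shape-loop k [] s _ _ _ _ shape = shape
  shape-loop k (p ∷ ps) s v-marked fuel within closedᵥ shape
    with faulty F v (nbr G v p) in faulty-p | marked s (nbr G v p) in seen
  ... | true  | _     = shape-loop k ps s v-marked fuel within closedᵥ shape
  ... | false | true  = shape-loop k ps s v-marked fuel within closedᵥ shape
  ... | false | false =
    shape-loop k ps (goBack e) (E.grows v v-marked) (≤-trans fuel (+-monoʳ-≤ k (count-mono E.grows)))
               E.within closed′ shape′
    where
    u : Fin n
    u = nbr G v p
    edge : FreeEdge v u
    edge = (p , refl) , faulty-p
    e : St n
    e = explore k u (goNew s)
    E : ExploreSpec u (goNew s) e
    E = explore-spec k u (goNew s) seen fuel within (inC-step (within v v-marked) edge)
    module E = ExploreSpec E
    closed′ : ClosedAwayFromV (goBack e)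
    closed′ y y-seen y≢v z y-z with marked s y in before
    ... | true  = E.grows z (closedᵥ y before y≢v z y-z)
    ... | false = E.closed y y-seen before z y-z
    shape′ : Shape (goBack e)
    shape′ with E.progress
    ... | inj₁ moved                = returned (s≤s moved)
    ... | inj₂ (same , now , marks) =
      pendant-last {u = u} (cong suc (trans same (sym now)))
                   (pendant-child {s} {e} v-marked closedᵥ seen edge E marks)

  initial : St n
  initial = st (λ _ → false) 0 0

  count-initial : C (mark v initial) ≡ 1
  count-initial = trans (count-mark initial v refl) (cong suc (count-false n))

  run-shape : ∀ k → n ≤ k → Shape (explore k v initial)
  run-shape zero    _    = nothing-new refl
  run-shape (suc k) fuel =
    shape-loop k (ports v) (mark v initial) (mark-here initial v) fuel′ within₀ closed₀ (nothing-new refl)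
    where
    only-v : ∀ y → Marked (mark v initial) y → y ≡ v
    only-v y m with y ≟ v
    ... | yes y≡v = y≡v
    ... | no _    = ⊥-elim (true≢false (sym m))
    fuel′ : n ≤ k + C (mark v initial)
    fuel′ = subst (λ c → n ≤ k + c) (sym count-initial) (subst (n ≤_) (+-comm 1 k) fuel)
    within₀ : WithinC (mark v initial)
    within₀ y m rewrite only-v y m = [] , stop , here refl
    closed₀ : ClosedAwayFromV (mark v initial)
    closed₀ y m y≢v = ⊥-elim (y≢v (only-v y m))

  run : St n
  run = explore n v initial

  run-spec : ExploreSpec v initial run
  run-spec = explore-spec n v initial refl (m≤m+n n (C initial)) (λ _ ()) ([] , stop , here refl)

  run-count : ∃[ d ] (C run ≡ suc d × moves run ≡ 2 * d)
  run-count with ExploreSpec.spent run-spec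
  ... | d , count-run , moves-run = d , trans count-run (cong (_+ d) count-initial) , moves-run

  on-cover : ∀ {s ws} → Covers G F v ws → WithinC s → ∀ x → Marked s x → x ∈ v ∷ ws
  on-cover (_ , covers) within x m = covers x (within x m)

  cover-bound : ∀ {s ws} → Covers G F v ws → WithinC s → C s ≤ suc (length ws)
  cover-bound {s} {ws} covering within = count-≤-length (v ∷ ws) (on-cover {s} covering within)

  pendant-on-cover : ∀ {ws u} → Covers G F v ws → Pendant u → u ∈ ws
  pendant-on-cover (_ , covers) (u≢v , edge , _) with covers _ (inC-step ([] , stop , here refl) edge)
  ... | here u≡v   = ⊥-elim (u≢v u≡v)
  ... | there u∈ws = u∈ws

  cover-bound-pendant : ∀ {s ws u} → Covers G F v ws → WithinC s → Pendant u →
                        C s ≤ length ws ⊎ length ws ≡ 1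
  cover-bound-pendant {s} {ws} covering within pendant@(_ , _ , only-v)
    with through-pendant (λ y y-u → only-v y (free-sym y-u)) only-v (proj₁ covering)
                         (pendant-on-cover covering pendant)
  ... | inj₂ refl = inj₂ refl
  ... | inj₁ v∈ws = inj₁ (count-≤-length ws on-ws)
    where
    on-ws : ∀ x → Marked s x → x ∈ ws
    on-ws x m with on-cover {s} covering within x m
    ... | here refl  = v∈ws
    ... | there x∈ws = x∈ws

lemma3p1 : ∀ {n : ℕ} (G : PortGraph n) → Connected G → 3 ≤ n → Hamiltonian G →
           (α : PortOrders G) (v : Fin n) (F : Faults n) (k : ℕ) → IsOpt G F v k →
           dfsCost G α F v * (n ∸ 1) ≤ (2 * n ∸ 4) * k
lemma3p1 {suc (suc s)} G _ (s≤s (s≤s 1≤s)) _ α v F _ ((ws , covering , refl) , _) =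
  subst (λ a → lastDisc run * suc s ≤ a * length ws) (sym (double-minus-four s))
        (by-shape (run-shape _ ≤-refl))
  where
  open DFSInvariants G α F v
  d : ℕ
  d = proj₁ run-count
  marks-run : C run ≡ suc d
  marks-run = proj₁ (proj₂ run-count)
  moves-run : moves run ≡ 2 * d
  moves-run = proj₂ (proj₂ run-count)
  within : WithinC run
  within = ExploreSpec.within run-spec
  d≤1+s : d ≤ 1 + s
  d≤1+s = ≤-pred (subst (_≤ 2 + s) marks-run (count-≤ (marked run)))
  d≤k : d ≤ length ws
  d≤k = ≤-pred (subst (_≤ suc (length ws)) marks-run (cover-bound {run} covering within))
  by-shape : Shape run → lastDisc run * (1 + s) ≤ 2 * s * length ws
  by-shape (returned two-after) =
    bound-when-returned (subst (2 + lastDisc run ≤_) moves-run two-after) d≤1+s d≤k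
  by-shape (nothing-new none) rewrite none = z≤n
  by-shape (pendant-last one-after pendant) =
    bound-when-pendant 1≤s (trans one-after moves-run) d≤1+s d≤k long-or-short
    where
    long-or-short : suc d ≤ length ws ⊎ d ≤ 1
    long-or-short with cover-bound-pendant {run} covering within pendant
    ... | inj₁ bound = inj₁ (subst (_≤ length ws) marks-run bound)
    ... | inj₂ one   = inj₂ (subst (d ≤_) one d≤k)
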